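{- Let $p\geq 5$ be a prime, $H$ a positive integer, and $X>1$ a real number with $XH<p$. Then the intervals $\mathcal{I}(q,t)$, where $(q,t)$ ranges over pairs of integers with $0\leq t<q\leq X$ and $\gcd(t,q)=1$, are pairwise disjoint (distinct pairs give disjoint intervals); and similarly the intervals $\mathcal{J}(q,t)$ for such pairs are pairwise disjoint.
   Context: For integers $0\leq t<q$, define the real intervals $$\mathcal{I}(q,t)=\left(\frac{pt}{q},\frac{H+pt}{q}\right],\qquad \mathcal{J}(q,t)=\left[-\frac{H+pt}{q},-\frac{pt}{q}\right).$$
   Formalization: The parameter X ranges over the rationals instead of the reals, and the intervals $\mathcal{I}(q,t)$ and $\mathcal{J}(q,t)$ are taken as sets of rational numbers. -}

module Defs where

open import Data.Nat as ℕ using (ℕ; zero; suc)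
open import Data.Integer as ℤ using (ℤ; +_)
open import Data.Rational as ℚ using (ℚ; _/_; _<_; _≤_; -_)
open import Data.Product using (_×_)

-- The rational number n / q.  Only used with q ≥ 1 (since 0 ≤ t < q);
-- the value chosen for q = 0 is an irrelevant convention.
frac : ℤ → ℕ → ℚ
frac n zero    = ℚ.0ℚ
frac n (suc k) = n / suc k

ι : ℕ → ℚ
ι n = + n / 1

_∈𝓘[_,_,_,_] : ℚ → ℕ → ℕ → ℕ → ℕ → Set
x ∈𝓘[ p , H , q , t ] =
  (frac (+ (p ℕ.* t)) q < x) × (x ≤ frac (+ (H ℕ.+ p ℕ.* t)) q)

_∈𝓙[_,_,_,_] : ℚ → ℕ → ℕ → ℕ → ℕ → Set
x ∈𝓙[ p , H , q , t ] =
  (- frac (+ (H ℕ.+ p ℕ.* t)) q ≤ x) × (x < - frac (+ (p ℕ.* t)) q)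

{-# OPTIONS --safe #-}
-- If 𝓘(q,t) and 𝓘(q′,t′) meet, each left endpoint lies below the other right endpoint.
-- Cross-multiplying, p (t′ q − t q′) < q′ H ≤ X H < p and symmetrically, so t q′ = t′ q;
-- as both fractions are reduced, (q,t) = (q′,t′).  Negation maps 𝓙(q,t) onto 𝓘(q,t).
module Submission where

open import Defs
open import Data.Nat as ℕ using (ℕ; suc; s≤s)
import Data.Nat.Properties as ℕP
open import Data.Nat.Divisibility using (divides; ∣-antisym)
open import Data.Nat.Coprimality as Coprime using (coprime-divisor; gcd≡1⇒coprime)
open import Data.Nat.GCD using (gcd)
open import Data.Nat.Primality using (Prime)
open import Data.Nat.Tactic.RingSolver using (solve-∀)
open import Data.Integer as ℤ using (+_)
import Data.Integer.Properties as ℤP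
open import Data.Rational as ℚ using (ℚ; fromℚᵘ; toℚᵘ)
import Data.Rational.Properties as ℚP
open import Data.Rational.Unnormalised as ℚᵘ using (mkℚᵘ)
import Data.Rational.Unnormalised.Properties as ℚᵘP
open import Algebra.Properties.Group ℚP.+-0-group using (⁻¹-involutive)
open import Data.Product using (_×_; _,_)
open import Relation.Binary.PropositionalEquality
open import Relation.Nullary using (¬_)

fromℚᵘ-cancel-< : ∀ {p q} → fromℚᵘ p ℚ.< fromℚᵘ q → p ℚᵘ.< q
fromℚᵘ-cancel-< {p} {q} h =
  ℚᵘP.<-respʳ-≃ (ℚP.toℚᵘ-fromℚᵘ q) (ℚᵘP.<-respˡ-≃ (ℚP.toℚᵘ-fromℚᵘ p) (ℚP.toℚᵘ-mono-< h))

frac-cancel-< : ∀ a b k k′ → frac (+ a) (suc k) ℚ.< frac (+ b) (suc k′) →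
                a ℕ.* suc k′ ℕ.< b ℕ.* suc k
frac-cancel-< a b k k′ h with fromℚᵘ-cancel-< {mkℚᵘ (+ a) k} {mkℚᵘ (+ b) k′} h
... | ℚᵘ.*<* ab = ℤP.drop‿+<+ (subst₂ ℤ._<_ (sym (ℤP.pos-* a _)) (sym (ℤP.pos-* b _)) ab)

ι-cancel-< : ∀ {m n} → ι m ℚ.< ι n → m ℕ.< n
ι-cancel-< {m} {n} h =
  subst₂ ℕ._<_ (ℕP.*-identityʳ m) (ℕP.*-identityʳ n) (frac-cancel-< m n 0 0 h)

ι-homo-* : ∀ m n → ι m ℚ.* ι n ≡ ι (m ℕ.* n)
ι-homo-* m n = ℚP.toℚᵘ-injective (begin
  toℚᵘ (ι m ℚ.* ι n)                ≈⟨ ℚP.toℚᵘ-homo-* (ι m) (ι n) ⟩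
  toℚᵘ (ι m) ℚᵘ.* toℚᵘ (ι n)        ≈⟨ ℚᵘP.*-cong (ℚP.toℚᵘ-fromℚᵘ (mkℚᵘ (+ m) 0))
                                                    (ℚP.toℚᵘ-fromℚᵘ (mkℚᵘ (+ n) 0)) ⟩
  mkℚᵘ (+ m ℤ.* + n) 0              ≡⟨ cong (λ i → mkℚᵘ i 0) (sym (ℤP.pos-* m n)) ⟩
  mkℚᵘ (+ (m ℕ.* n)) 0              ≈⟨ ℚᵘP.≃-sym (ℚP.toℚᵘ-fromℚᵘ _) ⟩
  toℚᵘ (ι (m ℕ.* n))                ∎)
  where open ℚᵘP.≃-Reasoning

q≤X⇒q*H<p : ∀ q H p {X : ℚ} → ι q ℚ.≤ X → X ℚ.* ι H ℚ.< ι p → q ℕ.* H ℕ.< p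
q≤X⇒q*H<p q H p q≤X XH<p = ι-cancel-< (subst (ℚ._< ι p) (ι-homo-* q H)
  (ℚP.≤-<-trans (ℚP.*-monoʳ-≤-nonNeg (ι H) {{ℚP.normalize-nonNeg H 1}} q≤X) XH<p))

p*m<r+p*n⇒m≤n : ∀ p {m n r} → r ℕ.≤ p → p ℕ.* m ℕ.< r ℕ.+ p ℕ.* n → m ℕ.≤ n
p*m<r+p*n⇒m≤n p {m} {n} {r} r≤p pm<r+pn =
  ℕP.m<1+n⇒m≤n (ℕP.*-cancelˡ-< p m (suc n) (begin-strict
  p ℕ.* m            <⟨ pm<r+pn ⟩
  r ℕ.+ p ℕ.* n      ≤⟨ ℕP.+-monoˡ-≤ (p ℕ.* n) r≤p ⟩
  p ℕ.+ p ℕ.* n      ≡⟨ ℕP.*-suc p n ⟨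
  p ℕ.* suc n        ∎))
  where open ℕP.≤-Reasoning

left<right⇒cross-≤ : ∀ p H {q q′ t t′} → q′ ℕ.* H ℕ.≤ p →
                     p ℕ.* t′ ℕ.* q ℕ.< (H ℕ.+ p ℕ.* t) ℕ.* q′ → t′ ℕ.* q ℕ.≤ t ℕ.* q′
left<right⇒cross-≤ p H {q} {q′} {t} {t′} q′H≤p lt = p*m<r+p*n⇒m≤n p q′H≤p
  (subst₂ ℕ._<_ (lhs p t′ q) (rhs p t q′ H) lt)
  where
  lhs : ∀ p t′ q → p ℕ.* t′ ℕ.* q ≡ p ℕ.* (t′ ℕ.* q)
  lhs = solve-∀
  rhs : ∀ p t q′ H → (H ℕ.+ p ℕ.* t) ℕ.* q′ ≡ q′ ℕ.* H ℕ.+ p ℕ.* (t ℕ.* q′)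
  rhs = solve-∀

coprime-cross-≡⇒≡ : ∀ {q q′ t t′} .{{_ : ℕ.NonZero q}} → t ℕ.* q′ ≡ t′ ℕ.* q →
                    gcd t q ≡ 1 → gcd t′ q′ ≡ 1 → _≡_ {A = ℕ × ℕ} (q , t) (q′ , t′)
coprime-cross-≡⇒≡ {q} {q′} {t} {t′} tq′≡t′q tq-coprime t′q′-coprime
  with ∣-antisym
         (coprime-divisor {n = t} (Coprime.sym (gcd≡1⇒coprime tq-coprime)) (divides t′ tq′≡t′q))
         (coprime-divisor {n = t′} (Coprime.sym (gcd≡1⇒coprime t′q′-coprime)) (divides t (sym tq′≡t′q)))
... | refl = cong (q ,_) (ℕP.*-cancelʳ-≡ t t′ q tq′≡t′q)

𝓘-overlap⇒≡ : ∀ p H {q t q′ t′ x} → t ℕ.< q → t′ ℕ.< q′ →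
              q ℕ.* H ℕ.≤ p → q′ ℕ.* H ℕ.≤ p → gcd t q ≡ 1 → gcd t′ q′ ≡ 1 →
              x ∈𝓘[ p , H , q , t ] → x ∈𝓘[ p , H , q′ , t′ ] →
              _≡_ {A = ℕ × ℕ} (q , t) (q′ , t′)
𝓘-overlap⇒≡ p H {suc k} {t} {suc k′} {t′} (s≤s _) (s≤s _) qH≤p q′H≤p gq gq′
            (l , r) (l′ , r′) =
  coprime-cross-≡⇒≡ (ℕP.≤-antisym
    (left<right⇒cross-≤ p H qH≤p
      (frac-cancel-< (p ℕ.* t) (H ℕ.+ p ℕ.* t′) k k′ (ℚP.<-≤-trans l r′)))
    (left<right⇒cross-≤ p H q′H≤p
      (frac-cancel-< (p ℕ.* t′) (H ℕ.+ p ℕ.* t) k′ k (ℚP.<-≤-trans l′ r))))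
    gq gq′

𝓙⇒neg-𝓘 : ∀ p H q t {x} → x ∈𝓙[ p , H , q , t ] → (ℚ.- x) ∈𝓘[ p , H , q , t ]
𝓙⇒neg-𝓘 _ _ _ _ {x} (l , r) =
  subst (ℚ._< ℚ.- x) (⁻¹-involutive _) (ℚP.neg-antimono-< r) ,
  subst (ℚ.- x ℚ.≤_) (⁻¹-involutive _) (ℚP.neg-antimono-≤ l)

PairwiseDisjoint : (ℕ → ℕ → ℚ → Set) → ℚ → Set
PairwiseDisjoint Member X = ∀ (q t q′ t′ : ℕ) →
  t ℕ.< q → ι q ℚ.≤ X → gcd t q ≡ 1 →
  t′ ℕ.< q′ → ι q′ ℚ.≤ X → gcd t′ q′ ≡ 1 →
  (q , t) ≢ (q′ , t′) →
  ∀ (x : ℚ) → ¬ (Member q t x × Member q′ t′ x)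

PairwiseDisjoint-reindex : ∀ {A B : ℕ → ℕ → ℚ → Set} {X} (f : ℚ → ℚ) →
                           (∀ {q t x} → B q t x → A q t (f x)) →
                           PairwiseDisjoint A X → PairwiseDisjoint B X
PairwiseDisjoint-reindex f B⇒A disjoint q t q′ t′ t<q q≤X gq t′<q′ q′≤X gq′ distinct x (b , b′) =
  disjoint q t q′ t′ t<q q≤X gq t′<q′ q′≤X gq′ distinct (f x) (B⇒A b , B⇒A b′)

𝓘-disjoint : ∀ {p H X} → X ℚ.* ι H ℚ.< ι p →
             PairwiseDisjoint (λ q t x → x ∈𝓘[ p , H , q , t ]) X
𝓘-disjoint {p} {H} XH<p q t q′ t′ t<q q≤X gq t′<q′ q′≤X gq′ distinct x (x∈𝓘 , x∈𝓘′) =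
  distinct (𝓘-overlap⇒≡ p H t<q t′<q′
    (ℕP.<⇒≤ (q≤X⇒q*H<p q H p q≤X XH<p)) (ℕP.<⇒≤ (q≤X⇒q*H<p q′ H p q′≤X XH<p))
    gq gq′ x∈𝓘 x∈𝓘′)

𝓙-disjoint : ∀ {p H X} → X ℚ.* ι H ℚ.< ι p →
             PairwiseDisjoint (λ q t x → x ∈𝓙[ p , H , q , t ]) X
𝓙-disjoint {p} {H} XH<p =
  PairwiseDisjoint-reindex ℚ.-_ (λ {q} {t} → 𝓙⇒neg-𝓘 p H q t) (𝓘-disjoint {p} {H} XH<p)

lemma3p2 : (p H : ℕ) (X : ℚ) → Prime p → 5 ℕ.≤ p → 1 ℕ.≤ H →
    ℚ.1ℚ ℚ.< X → X ℚ.* ι H ℚ.< ι p →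
    (∀ (q t q′ t′ : ℕ) →
      t ℕ.< q → ι q ℚ.≤ X → gcd t q ≡ 1 →
      t′ ℕ.< q′ → ι q′ ℚ.≤ X → gcd t′ q′ ≡ 1 →
      (q , t) ≢ (q′ , t′) →
      ∀ (x : ℚ) → ¬ (x ∈𝓘[ p , H , q , t ] × x ∈𝓘[ p , H , q′ , t′ ]))
    ×
    (∀ (q t q′ t′ : ℕ) →
      t ℕ.< q → ι q ℚ.≤ X → gcd t q ≡ 1 →
      t′ ℕ.< q′ → ι q′ ℚ.≤ X → gcd t′ q′ ≡ 1 →
      (q , t) ≢ (q′ , t′) →
      ∀ (x : ℚ) → ¬ (x ∈𝓙[ p , H , q , t ] × x ∈𝓙[ p , H , q′ , t′ ]))
lemma3p2 p H X _ _ _ _ XH<p = 𝓘-disjoint {p} {H} XH<p , 𝓙-disjoint {p} {H} XH<p
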